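{- Let $n\ge1$ and let $G_{2,n}$ be the complete bipartite directed graph with vertex set $A\cup B$, $A=\{a_1,a_2\}$, $B=\{b_1,\dots,b_n\}$, and edge set $A\times B$ (all edges $(a_h,b_i)$ directed from $a_h$ to $b_i$). Writing the variable attached to each vertex by the same letter as the vertex, one has $$N(G_{2,n})=\sum_{i=1}^n\left(\prod_{j<i}(a_1-b_j)\cdot\prod_{k>i}(a_2-b_k)\right).$$
   Context: For a finite directed graph $G$ with vertex set $V$ and edge set $E\subset V\times V$ (an edge $e=(u,v)$ has origin $\alpha(e)=u$ and end $\omega(e)=v$), a linear extension is a total order on $V$ with $\alpha(e)$ before $\omega(e)$ for every edge, written as the word $w=w_1\cdots w_{|V|}$ in increasing order; $\mathcal L(G)$ is their set. $\Psi(G)=\sum_{w\in\mathcal L(G)}\prod_{i=1}^{|V|-1}(x_{w_i}-x_{w_{i+1}})^{ -1}$ and $N(G)=\Psi(G)\prod_{e\in E}(x_{\alpha(e)}-x_{\omega(e)})$. -}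

module Defs where

open import Data.Bool using (Bool; true; false; _∧_; if_then_else_)
open import Data.Nat using (ℕ; zero; suc)
open import Data.Fin using (Fin; zero; suc; toℕ)
import Data.Fin as F
open import Data.Fin.Properties using () renaming (_≟_ to _≟ᶠ_)
open import Data.List using (List; []; _∷_; map; concatMap; foldr; filterᵇ; allFin; _++_)
open import Data.Product using (_×_; _,_)
open import Data.Rational using (ℚ; 0ℚ; 1ℚ; _-_; _*_; _+_; 1/_; ≢-nonZero)
open import Data.Rational.Properties using (_≟_)
open import Relation.Nullary using (yes; no; does)
import Data.Nat as N

sumℚ : List ℚ → ℚ
sumℚ = foldr _+_ 0ℚ

prodℚ : List ℚ → ℚ
prodℚ = foldr _*_ 1ℚ

-- total inverse: inv 0 = 0 (only ever applied to nonzero arguments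
-- under the distinctness hypothesis of the theorem)
inv : ℚ → ℚ
inv p with p ≟ 0ℚ
... | yes _ = 0ℚ
... | no p≢0 = 1/_ p {{≢-nonZero p≢0}}

-- all permutations of a list (for a list without repetitions, each
-- permutation occurs exactly once)
insertions : {A : Set} → A → List A → List (List A)
insertions x [] = (x ∷ []) ∷ []
insertions x (y ∷ ys) = (x ∷ y ∷ ys) ∷ map (y ∷_) (insertions x ys)

perms : {A : Set} → List A → List (List A)
perms [] = [] ∷ []
perms (x ∷ xs) = concatMap (insertions x) (perms xs)

-- A directed graph on vertex set Fin m, given by its list of edges (u , v)
-- with origin u and end v.
record DiGraph (m : ℕ) : Set where
  field
    edges : List (Fin m × Fin m)
open DiGraph public

before : {m : ℕ} → Fin m → Fin m → List (Fin m) → Bool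
before u v [] = false
before u v (z ∷ w) with does (z ≟ᶠ u) | does (z ≟ᶠ v)
... | _     | true  = false
... | true  | false = true
... | false | false = before u v w

respects : {m : ℕ} → DiGraph m → List (Fin m) → Bool
respects G w = foldr (λ { (u , v) r → before u v w ∧ r }) true (edges G)

-- the set L(G) of linear extensions, as words listing all vertices in
-- increasing order
linExt : {m : ℕ} → DiGraph m → List (List (Fin m))
linExt G = filterᵇ (respects G) (perms (allFin _))

consecInvProd : {m : ℕ} → (Fin m → ℚ) → List (Fin m) → ℚ
consecInvProd x (a ∷ b ∷ w) = inv (x a - x b) * consecInvProd x (b ∷ w)
consecInvProd x _ = 1ℚ

Ψ : {m : ℕ} → DiGraph m → (Fin m → ℚ) → ℚ
Ψ G x = sumℚ (map (consecInvProd x) (linExt G))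

N : {m : ℕ} → DiGraph m → (Fin m → ℚ) → ℚ
N G x = Ψ G x * prodℚ (map (λ { (u , v) → x u - x v }) (edges G))

-- G_{2,n}: vertices Fin (2 + n); zero = a₁, suc zero = a₂, suc (suc i) = b_{i+1}
vA₁ vA₂ : {n : ℕ} → Fin (2 N.+ n)
vA₁ = zero
vA₂ = suc zero

vB : {n : ℕ} → Fin n → Fin (2 N.+ n)
vB i = suc (suc i)

G2 : (n : ℕ) → DiGraph (2 N.+ n)
G2 n = record { edges = map (λ i → (vA₁ , vB i)) (allFin n) ++ map (λ i → (vA₂ , vB i)) (allFin n) }

xG2 : {n : ℕ} → ℚ → ℚ → (Fin n → ℚ) → Fin (2 N.+ n) → ℚ
xG2 a₁ a₂ b zero = a₁
xG2 a₁ a₂ b (suc zero) = a₂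
xG2 a₁ a₂ b (suc (suc i)) = b i

rhsG2 : {n : ℕ} → ℚ → ℚ → (Fin n → ℚ) → ℚ
rhsG2 {n} a₁ a₂ b =
  sumℚ (map (λ i →
      prodℚ (map (λ j → a₁ - b j) (filterᵇ (λ j → toℕ j N.<ᵇ toℕ i) (allFin n)))
    * prodℚ (map (λ k → a₂ - b k) (filterᵇ (λ k → toℕ i N.<ᵇ toℕ k) (allFin n))))
    (allFin n))

module Submission where

-- A linear extension of G₂,ₙ must start with the two sources, so
-- L(G₂,ₙ) consists of the words a₁a₂σ and a₂a₁σ, σ an ordering of the sinks.
-- Their weights are 1/(a₁-a₂)·chain(a₂σ) and 1/(a₂-a₁)·chain(a₁σ), where
-- chain(p₁…pₖ) = ∏ 1/(pᵢ - pᵢ₊₁).  The classical permutation-sum identity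
--   Σ_σ chain(yσ) = ∏ᵢ 1/(y - bᵢ)            (distinct y, b₁, …, bₙ)
-- follows from the partial-fraction identity by induction, inserting one
-- letter at a time.  Hence Ψ = (1/(a₁-a₂))·(1/D₂ - 1/D₁) with Dₕ = ∏ᵢ (aₕ - bᵢ),
-- the edge product is D₁·D₂, and N = (D₁ - D₂)/(a₁ - a₂), which is the
-- right-hand side because the latter telescopes: RHS·(a₁ - a₂) = D₁ - D₂.

open import Defs
open import Data.Nat using (ℕ; _≤_)
open import Data.Fin using (Fin)
open import Data.Rational using (ℚ)
open import Relation.Binary.PropositionalEquality using (_≡_; _≢_)

import Data.Nat as Nat
open import Data.Bool using (Bool; true; false; T)
open import Data.Bool.Properties using (T-∧)
open import Data.Empty using (⊥-elim)
open import Data.Fin using (zero; suc; toℕ)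
open import Data.Fin.Properties using () renaming (_≟_ to _≟ᶠ_)
open import Data.List using (List; []; _∷_; _++_; map; concatMap; filter; filterᵇ; allFin)
open import Data.List.Properties
  using (map-∘; map-++; map-cong; map-cong-local; map-tabulate; map-concatMap; concatMap-++; concatMap-cong; concatMap-map;
         filter-++; filter-accept; filter-none; filter-all)
open import Data.List.Membership.Propositional.Properties using (∈-allFin)
open import Data.List.Relation.Unary.All using (All; []; _∷_)
import Data.List.Relation.Unary.All as All
import Data.List.Relation.Unary.All.Properties as AllP
open import Data.List.Relation.Unary.Any using (Any; here; there)
import Data.List.Relation.Unary.Any as Any
import Data.List.Relation.Unary.Any.Properties as AnyP
open import Data.List.Relation.Unary.AllPairs using (_∷_)
open import Data.List.Relation.Unary.Unique.Propositional using (Unique)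
import Data.List.Relation.Unary.Unique.Propositional.Properties as Unique
open import Data.List.Relation.Binary.Permutation.Propositional using (_↭_; ↭-refl; ↭-prep; ↭-swap; ↭-trans; ↭-sym; ↭⇒↭ₛ)
open import Data.List.Relation.Binary.Permutation.Setoid.Properties using (Unique-resp-↭)
open import Data.Product using (_×_; _,_; proj₁; proj₂)
open import Data.Rational using (0ℚ; 1ℚ; _+_; _*_; _-_; -_; ≢-nonZero)
import Data.Rational.Properties as ℚ
open import Data.Rational.Solver using (module +-*-Solver)
open import Data.Unit using (tt)
open import Function using (_∘_; id)
open import Function.Bundles using (Equivalence)
open import Level using (Level; 0ℓ)
open import Relation.Binary.PropositionalEquality using (refl; sym; trans; cong; cong₂; subst; setoid; module ≡-Reasoning)
open import Relation.Nullary using (¬_; yes; no)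
open import Relation.Nullary.Decidable using (dec-true; T?; decidable-stable)
open import Relation.Unary using (Pred; Decidable)

open ≡-Reasoning
open +-*-Solver using (solve; _:=_; _:+_; _:*_; _:-_; :-_; con)

module _ {A B : Set} where

  filterᵇ-map : (p : B → Bool) (f : A → B) (xs : List A) →
    filterᵇ p (map f xs) ≡ map f (filterᵇ (p ∘ f) xs)
  filterᵇ-map p f [] = refl
  filterᵇ-map p f (x ∷ xs) with p (f x)
  ... | true  = cong (f x ∷_) (filterᵇ-map p f xs)
  ... | false = filterᵇ-map p f xs

  filter-concatMap : {ℓ : Level} {P : Pred B ℓ} (P? : Decidable P) (f : A → List B) (xs : List A) →
    filter P? (concatMap f xs) ≡ concatMap (filter P? ∘ f) xs
  filter-concatMap P? f [] = refl
  filter-concatMap P? f (x ∷ xs) =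
    trans (filter-++ P? (f x) _) (cong (filter P? (f x) ++_) (filter-concatMap P? f xs))

  concatMap-concatMap : {C : Set} (g : B → List C) (f : A → List B) (xs : List A) →
    concatMap g (concatMap f xs) ≡ concatMap (concatMap g ∘ f) xs
  concatMap-concatMap g f [] = refl
  concatMap-concatMap g f (x ∷ xs) =
    trans (concatMap-++ g (f x) _) (cong (concatMap g (f x) ++_) (concatMap-concatMap g f xs))

  insertions-map : (f : A → B) (x : A) (ys : List A) →
    insertions (f x) (map f ys) ≡ map (map f) (insertions x ys)
  insertions-map f x [] = refl
  insertions-map f x (y ∷ ys) = cong ((f x ∷ f y ∷ map f ys) ∷_) (begin
    map (f y ∷_) (insertions (f x) (map f ys))   ≡⟨ cong (map (f y ∷_)) (insertions-map f x ys) ⟩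
    map (f y ∷_) (map (map f) (insertions x ys)) ≡⟨ map-∘ (insertions x ys) ⟨
    map (map f ∘ (y ∷_)) (insertions x ys)       ≡⟨ map-∘ (insertions x ys) ⟩
    map (map f) (map (y ∷_) (insertions x ys))   ∎)

  perms-map : (f : A → B) (xs : List A) → perms (map f xs) ≡ map (map f) (perms xs)
  perms-map f [] = refl
  perms-map f (x ∷ xs) = begin
    concatMap (insertions (f x)) (perms (map f xs))        ≡⟨ cong (concatMap (insertions (f x))) (perms-map f xs) ⟩
    concatMap (insertions (f x)) (map (map f) (perms xs))  ≡⟨ concatMap-map (insertions (f x)) (map f) (perms xs) ⟩
    concatMap (insertions (f x) ∘ map f) (perms xs)        ≡⟨ concatMap-cong (insertions-map f x) (perms xs) ⟩
    concatMap (map (map f) ∘ insertions x) (perms xs)      ≡⟨ map-concatMap (map f) (insertions x) (perms xs) ⟨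
    map (map f) (concatMap (insertions x) (perms xs))      ∎

module _ {A : Set} where

  insertions-↭ : (x : A) (ys : List A) → All (_↭ x ∷ ys) (insertions x ys)
  insertions-↭ x [] = ↭-refl ∷ []
  insertions-↭ x (y ∷ ys) = ↭-refl ∷ AllP.map⁺ (All.map behind-y (insertions-↭ x ys))
    where
    behind-y : {w : List A} → w ↭ x ∷ ys → y ∷ w ↭ x ∷ y ∷ ys
    behind-y w↭ = ↭-trans (↭-prep y w↭) (↭-swap y x ↭-refl)

  perms-↭ : (xs : List A) → All (_↭ xs) (perms xs)
  perms-↭ [] = ↭-refl ∷ []
  perms-↭ (x ∷ xs) = AllP.concat⁺ (AllP.map⁺ (All.map insert-x (perms-↭ xs)))
    where
    insert-x : {σ : List A} → σ ↭ xs → All (_↭ x ∷ xs) (insertions x σ)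
    insert-x σ↭xs = All.map (λ w↭ → ↭-trans w↭ (↭-prep x σ↭xs)) (insertions-↭ x _)

sumℚ-++ : (xs ys : List ℚ) → sumℚ (xs ++ ys) ≡ sumℚ xs + sumℚ ys
sumℚ-++ [] ys = sym (ℚ.+-identityˡ _)
sumℚ-++ (x ∷ xs) ys = trans (cong (x +_) (sumℚ-++ xs ys)) (sym (ℚ.+-assoc x _ _))

prodℚ-++ : (xs ys : List ℚ) → prodℚ (xs ++ ys) ≡ prodℚ xs * prodℚ ys
prodℚ-++ [] ys = sym (ℚ.*-identityˡ _)
prodℚ-++ (x ∷ xs) ys = trans (cong (x *_) (prodℚ-++ xs ys)) (sym (ℚ.*-assoc x _ _))

module _ {A : Set} where

  sumℚ-concatMap : {B : Set} (g : B → ℚ) (f : A → List B) (xs : List A) →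
    sumℚ (map g (concatMap f xs)) ≡ sumℚ (map (λ a → sumℚ (map g (f a))) xs)
  sumℚ-concatMap g f [] = refl
  sumℚ-concatMap g f (x ∷ xs) = begin
    sumℚ (map g (f x ++ concatMap f xs))               ≡⟨ cong sumℚ (map-++ g (f x) _) ⟩
    sumℚ (map g (f x) ++ map g (concatMap f xs))       ≡⟨ sumℚ-++ (map g (f x)) _ ⟩
    sumℚ (map g (f x)) + sumℚ (map g (concatMap f xs)) ≡⟨ cong (sumℚ (map g (f x)) +_) (sumℚ-concatMap g f xs) ⟩
    sumℚ (map (λ a → sumℚ (map g (f a))) (x ∷ xs))     ∎

  sumℚ-*ˡ : (c : ℚ) (f : A → ℚ) (xs : List A) → sumℚ (map (λ a → c * f a) xs) ≡ c * sumℚ (map f xs)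
  sumℚ-*ˡ c f [] = sym (ℚ.*-zeroʳ c)
  sumℚ-*ˡ c f (x ∷ xs) = trans (cong (c * f x +_) (sumℚ-*ˡ c f xs)) (sym (ℚ.*-distribˡ-+ c (f x) _))

  sumℚ-*ʳ : (c : ℚ) (f : A → ℚ) (xs : List A) → sumℚ (map (λ a → f a * c) xs) ≡ sumℚ (map f xs) * c
  sumℚ-*ʳ c f [] = sym (ℚ.*-zeroˡ c)
  sumℚ-*ʳ c f (x ∷ xs) = trans (cong (f x * c +_) (sumℚ-*ʳ c f xs)) (sym (ℚ.*-distribʳ-+ c (f x) _))

  sumℚ-+ : (f g : A → ℚ) (xs : List A) → sumℚ (map (λ a → f a + g a) xs) ≡ sumℚ (map f xs) + sumℚ (map g xs)
  sumℚ-+ f g [] = sym (ℚ.+-identityˡ 0ℚ)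
  sumℚ-+ f g (x ∷ xs) = trans (cong (f x + g x +_) (sumℚ-+ f g xs))
    (solve 4 (λ p q r s → (p :+ q) :+ (r :+ s) := (p :+ r) :+ (q :+ s)) refl (f x) (g x) (sumℚ (map f xs)) (sumℚ (map g xs)))

inv-inverseˡ : (p : ℚ) → p ≢ 0ℚ → inv p * p ≡ 1ℚ
inv-inverseˡ p p≢0 with p ℚ.≟ 0ℚ
... | yes p≡0 = ⊥-elim (p≢0 p≡0)
... | no p≢0′ = ℚ.*-inverseˡ p {{≢-nonZero p≢0′}}

diff≢0 : {x y : ℚ} → x ≢ y → x - y ≢ 0ℚ
diff≢0 {x} {y} x≢y x-y≡0 = x≢y (begin
  x             ≡⟨ solve 2 (λ x y → x := (x :- y) :+ y) refl x y ⟩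
  (x - y) + y   ≡⟨ cong (_+ y) x-y≡0 ⟩
  0ℚ + y        ≡⟨ ℚ.+-identityˡ y ⟩
  y             ∎)

inv-unique : (p q : ℚ) → p ≢ 0ℚ → q * p ≡ 1ℚ → q ≡ inv p
inv-unique p q p≢0 qp≡1 = begin
  q                ≡⟨ solve 1 (λ q → q := q :* con 1ℚ) refl q ⟩
  q * 1ℚ           ≡⟨ cong (q *_) (inv-inverseˡ p p≢0) ⟨
  q * (inv p * p)  ≡⟨ solve 3 (λ q i p → q :* (i :* p) := (q :* p) :* i) refl q (inv p) p ⟩
  (q * p) * inv p  ≡⟨ cong (_* inv p) qp≡1 ⟩
  1ℚ * inv p       ≡⟨ ℚ.*-identityˡ (inv p) ⟩
  inv p            ∎

inv-antisym : {x y : ℚ} → x ≢ y → inv (y - x) ≡ - inv (x - y)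
inv-antisym {x} {y} x≢y = sym (inv-unique (y - x) (- inv (x - y)) (diff≢0 (x≢y ∘ sym)) (begin
  (- inv (x - y)) * (y - x)  ≡⟨ solve 3 (λ i x y → (:- i) :* (y :- x) := i :* (x :- y)) refl (inv (x - y)) x y ⟩
  inv (x - y) * (x - y)      ≡⟨ inv-inverseˡ (x - y) (diff≢0 x≢y) ⟩
  1ℚ                         ∎))

partialFraction : (x b t : ℚ) → x ≢ b → x ≢ t → b ≢ t →
  inv (x - b) * inv (b - t) + inv (x - t) * inv (t - b) ≡ inv (x - t) * inv (x - b)
partialFraction x b t x≢b x≢t b≢t = begin
  u * v + w * inv (t - b)                               ≡⟨ cong (λ z → u * v + w * z) (inv-antisym b≢t) ⟩
  u * v + w * (- v)                                     ≡⟨ solve 3 (λ u v w → u :* v :+ w :* (:- v) := (u :* v) :* con 1ℚ :+ (w :* (:- v)) :* con 1ℚ) refl u v w ⟩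
  (u * v) * 1ℚ + (w * (- v)) * 1ℚ                       ≡⟨ cong₂ (λ α β → (u * v) * α + (w * (- v)) * β) (sym wx-t) (sym ux-b) ⟩
  (u * v) * (w * (x - t)) + (w * (- v)) * (u * (x - b)) ≡⟨ solve 6 (λ u v w x b t → (u :* v) :* (w :* (x :- t)) :+ (w :* (:- v)) :* (u :* (x :- b)) := (w :* u) :* (v :* (b :- t))) refl u v w x b t ⟩
  (w * u) * (v * (b - t))                               ≡⟨ cong ((w * u) *_) vb-t ⟩
  (w * u) * 1ℚ                                          ≡⟨ ℚ.*-identityʳ _ ⟩
  w * u                                                 ∎
  where
  u = inv (x - b)
  v = inv (b - t)
  w = inv (x - t)
  ux-b = inv-inverseˡ (x - b) (diff≢0 x≢b)
  vb-t = inv-inverseˡ (b - t) (diff≢0 b≢t)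
  wx-t = inv-inverseˡ (x - t) (diff≢0 x≢t)

prodℚ-inv : {A : Set} (f : A → ℚ) (xs : List A) → All (λ a → f a ≢ 0ℚ) xs →
  prodℚ (map (inv ∘ f) xs) * prodℚ (map f xs) ≡ 1ℚ
prodℚ-inv f [] [] = ℚ.*-identityˡ 1ℚ
prodℚ-inv f (x ∷ xs) (fx≢0 ∷ fxs≢0) = begin
  (inv (f x) * I) * (f x * P)     ≡⟨ solve 4 (λ i I d P → (i :* I) :* (d :* P) := (i :* d) :* (I :* P)) refl (inv (f x)) I (f x) P ⟩
  (inv (f x) * f x) * (I * P)     ≡⟨ cong₂ _*_ (inv-inverseˡ (f x) fx≢0) (prodℚ-inv f xs fxs≢0) ⟩
  1ℚ * 1ℚ                         ≡⟨ ℚ.*-identityˡ 1ℚ ⟩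
  1ℚ                              ∎
  where
  I = prodℚ (map (inv ∘ f) xs)
  P = prodℚ (map f xs)

-- The permutation sum

chainInv : List ℚ → ℚ
chainInv (p ∷ q ∷ r) = inv (p - q) * chainInv (q ∷ r)
chainInv _ = 1ℚ

consecInvProd-chainInv : {m : ℕ} (x : Fin m → ℚ) (w : List (Fin m)) → consecInvProd x w ≡ chainInv (map x w)
consecInvProd-chainInv x [] = refl
consecInvProd-chainInv x (u ∷ []) = refl
consecInvProd-chainInv x (u ∷ v ∷ w) = cong (inv (x u - x v) *_) (consecInvProd-chainInv x (v ∷ w))

insertion-sum : (x b : ℚ) (τ : List ℚ) → Unique (x ∷ b ∷ τ) →
  sumℚ (map (λ w → chainInv (x ∷ w)) (insertions b τ)) ≡ chainInv (x ∷ τ) * inv (x - b)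
insertion-sum x b [] _ = solve 1 (λ i → i :* con 1ℚ :+ con 0ℚ := con 1ℚ :* i) refl (inv (x - b))
insertion-sum x b (t ∷ τ) ((x≢b ∷ x≢t ∷ _) ∷ (b≢t ∷ b≢τ) ∷ t≢τ ∷ τ-distinct) = begin
  inv (x - b) * (inv (b - t) * F) + sumℚ (map (λ w → chainInv (x ∷ w)) (map (t ∷_) I))
    ≡⟨ cong (inv (x - b) * (inv (b - t) * F) +_) insertions-behind-t ⟩
  inv (x - b) * (inv (b - t) * F) + inv (x - t) * (F * inv (t - b))
    ≡⟨ solve 5 (λ u v w v′ F → u :* (v :* F) :+ w :* (F :* v′) := (u :* v :+ w :* v′) :* F) refl
         (inv (x - b)) (inv (b - t)) (inv (x - t)) (inv (t - b)) F ⟩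
  (inv (x - b) * inv (b - t) + inv (x - t) * inv (t - b)) * F
    ≡⟨ cong (_* F) (partialFraction x b t x≢b x≢t b≢t) ⟩
  (inv (x - t) * inv (x - b)) * F
    ≡⟨ solve 3 (λ w u F → (w :* u) :* F := (w :* F) :* u) refl (inv (x - t)) (inv (x - b)) F ⟩
  (inv (x - t) * F) * inv (x - b) ∎
  where
  F = chainInv (t ∷ τ)
  I = insertions b τ
  -- the insertions behind t, by induction with t as the new head
  insertions-behind-t : sumℚ (map (λ w → chainInv (x ∷ w)) (map (t ∷_) I)) ≡ inv (x - t) * (F * inv (t - b))
  insertions-behind-t = begin
    sumℚ (map (λ w → chainInv (x ∷ w)) (map (t ∷_) I)) ≡⟨ cong sumℚ (map-∘ I) ⟨
    sumℚ (map (λ w → inv (x - t) * chainInv (t ∷ w)) I) ≡⟨ sumℚ-*ˡ (inv (x - t)) (λ w → chainInv (t ∷ w)) I ⟩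
    inv (x - t) * sumℚ (map (λ w → chainInv (t ∷ w)) I) ≡⟨ cong (inv (x - t) *_) (insertion-sum t b τ ((b≢t ∘ sym ∷ t≢τ) ∷ b≢τ ∷ τ-distinct)) ⟩
    inv (x - t) * (F * inv (t - b))                     ∎

permutation-sum : (x : ℚ) (vs : List ℚ) → Unique (x ∷ vs) →
  sumℚ (map (λ τ → chainInv (x ∷ τ)) (perms vs)) ≡ prodℚ (map (λ v → inv (x - v)) vs)
permutation-sum x [] _ = ℚ.+-identityʳ 1ℚ
permutation-sum x (v ∷ vs) distinct@((x≢v ∷ x≢vs) ∷ _ ∷ vs-distinct) = begin
  sumℚ (map g (concatMap (insertions v) (perms vs)))                 ≡⟨ sumℚ-concatMap g (insertions v) (perms vs) ⟩
  sumℚ (map (λ τ → sumℚ (map g (insertions v τ))) (perms vs))        ≡⟨ cong sumℚ (map-cong-local (All.map (insertion-sum x v _ ∘ still-distinct) (perms-↭ vs))) ⟩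
  sumℚ (map (λ τ → g τ * inv (x - v)) (perms vs))                    ≡⟨ sumℚ-*ʳ (inv (x - v)) g (perms vs) ⟩
  sumℚ (map g (perms vs)) * inv (x - v)                              ≡⟨ cong (_* inv (x - v)) (permutation-sum x vs (x≢vs ∷ vs-distinct)) ⟩
  prodℚ (map (λ v → inv (x - v)) vs) * inv (x - v)                   ≡⟨ ℚ.*-comm _ (inv (x - v)) ⟩
  inv (x - v) * prodℚ (map (λ v → inv (x - v)) vs)                   ∎
  where
  g : List ℚ → ℚ
  g τ = chainInv (x ∷ τ)
  still-distinct : {τ : List ℚ} → τ ↭ vs → Unique (x ∷ v ∷ τ)
  still-distinct τ↭vs = Unique-resp-↭ (setoid ℚ) (↭⇒↭ₛ (↭-prep x (↭-prep v (↭-sym τ↭vs)))) distinct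

module _ {m : ℕ} where

  respects-accept : (es : List (Fin m × Fin m)) (w : List (Fin m)) →
    All (λ e → T (before (proj₁ e) (proj₂ e) w)) es → T (respects (record { edges = es }) w)
  respects-accept [] w [] = tt
  respects-accept (e ∷ es) w (ok ∷ oks) = Equivalence.from T-∧ (ok , respects-accept es w oks)

  respects-reject : (es : List (Fin m × Fin m)) (w : List (Fin m)) →
    Any (λ e → ¬ T (before (proj₁ e) (proj₂ e) w)) es → ¬ T (respects (record { edges = es }) w)
  respects-reject (e ∷ es) w (here bad) ok = bad (proj₁ (Equivalence.to T-∧ ok))
  respects-reject (e ∷ es) w (there bad) ok = respects-reject es w bad (proj₂ (Equivalence.to T-∧ ok))

  before-blocked : (u v : Fin m) (t : List (Fin m)) → ¬ T (before u v (v ∷ t))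
  before-blocked u v t rewrite dec-true (v ≟ᶠ v) refl = λ ()

-- The linear extensions of G₂,ₙ

module _ {n : ℕ} where

  V : Set
  V = Fin (2 Nat.+ n)

  respects? : Decidable (T ∘ respects (G2 n))
  respects? = T? ∘ respects (G2 n)

  G2-all-edges : {P : Pred (V × V) 0ℓ} → (∀ i → P (vA₁ , vB i)) → (∀ i → P (vA₂ , vB i)) → All P (edges (G2 n))
  G2-all-edges P₁ P₂ = AllP.++⁺ (AllP.map⁺ (All.universal P₁ (allFin n))) (AllP.map⁺ (All.universal P₂ (allFin n)))

  G2-reject₁ : (j : Fin n) (w : List V) → ¬ T (before vA₁ (vB j) w) → ¬ T (respects (G2 n) w)
  G2-reject₁ j w bad = respects-reject (edges (G2 n)) w (AnyP.++⁺ˡ (AnyP.map⁺ (Any.map (λ { refl → bad }) (∈-allFin j))))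

  G2-reject₂ : (j : Fin n) (w : List V) → ¬ T (before vA₂ (vB j) w) → ¬ T (respects (G2 n) w)
  G2-reject₂ j w bad = respects-reject (edges (G2 n)) w
    (AnyP.++⁺ʳ (map (λ i → (vA₁ , vB i)) (allFin n)) (AnyP.map⁺ (Any.map (λ { refl → bad }) (∈-allFin j))))

  accepts-a₁a₂ : (w : List V) → T (respects (G2 n) (vA₁ ∷ vA₂ ∷ w))
  accepts-a₁a₂ w = respects-accept (edges (G2 n)) (vA₁ ∷ vA₂ ∷ w) (G2-all-edges (λ _ → tt) (λ _ → tt))

  accepts-a₂a₁ : (w : List V) → T (respects (G2 n) (vA₂ ∷ vA₁ ∷ w))
  accepts-a₂a₁ w = respects-accept (edges (G2 n)) (vA₂ ∷ vA₁ ∷ w) (G2-all-edges (λ _ → tt) (λ _ → tt))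

  rejects-b-first : (j : Fin n) (t : List V) → ¬ T (respects (G2 n) (vB j ∷ t))
  rejects-b-first j t = G2-reject₁ j (vB j ∷ t) (before-blocked vA₁ (vB j) t)

  rejects-b-after-a₁ : (j : Fin n) (t : List V) → ¬ T (respects (G2 n) (vA₁ ∷ vB j ∷ t))
  rejects-b-after-a₁ j t = G2-reject₂ j (vA₁ ∷ vB j ∷ t) (before-blocked vA₂ (vB j) t)

  rejects-b-after-a₂ : (j : Fin n) (t : List V) → ¬ T (respects (G2 n) (vA₂ ∷ vB j ∷ t))
  rejects-b-after-a₂ j t = G2-reject₁ j (vA₂ ∷ vB j ∷ t) (before-blocked vA₁ (vB j) t)

  keep : (w : List V) {ws : List (List V)} → T (respects (G2 n) w) →
    filterᵇ (respects (G2 n)) (w ∷ ws) ≡ w ∷ filterᵇ (respects (G2 n)) ws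
  keep w ok = filter-accept respects? ok

  frontPairs : List (Fin n) → List (List V)
  frontPairs σ = (vA₁ ∷ vA₂ ∷ map vB σ) ∷ (vA₂ ∷ vA₁ ∷ map vB σ) ∷ []

  -- The orderings of all vertices whose sinks appear in the order σ.
  candidates : List (Fin n) → List (List V)
  candidates σ = concatMap (insertions vA₁) (insertions vA₂ (map vB σ))

  candidates-filter : (σ : List (Fin n)) → filterᵇ (respects (G2 n)) (candidates σ) ≡ frontPairs σ
  candidates-filter [] =
    trans (keep (vA₁ ∷ vA₂ ∷ []) (accepts-a₁a₂ [])) (cong ((vA₁ ∷ vA₂ ∷ []) ∷_) (keep (vA₂ ∷ vA₁ ∷ []) (accepts-a₂a₁ [])))
  candidates-filter σ@(j ∷ σ′) = begin
    filterᵇ R ((vA₁ ∷ vA₂ ∷ w) ∷ (vA₂ ∷ vA₁ ∷ w) ∷ rest)  ≡⟨ keep (vA₁ ∷ vA₂ ∷ w) (accepts-a₁a₂ w) ⟩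
    (vA₁ ∷ vA₂ ∷ w) ∷ filterᵇ R ((vA₂ ∷ vA₁ ∷ w) ∷ rest) ≡⟨ cong ((vA₁ ∷ vA₂ ∷ w) ∷_) (keep (vA₂ ∷ vA₁ ∷ w) (accepts-a₂a₁ w)) ⟩
    (vA₁ ∷ vA₂ ∷ w) ∷ (vA₂ ∷ vA₁ ∷ w) ∷ filterᵇ R rest   ≡⟨ cong (λ l → (vA₁ ∷ vA₂ ∷ w) ∷ (vA₂ ∷ vA₁ ∷ w) ∷ l) (filter-none respects? rest-rejected) ⟩
    frontPairs σ                                         ∎
    where
    R = respects (G2 n)
    w = map vB σ
    -- every other candidate puts bⱼ among its first two letters
    rest : List (List V)
    rest = map (vA₂ ∷_) (map (vB j ∷_) (insertions vA₁ (map vB σ′)))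
        ++ concatMap (insertions vA₁) (map (vB j ∷_) (insertions vA₂ (map vB σ′)))
    bⱼ-first : (u : List V) → All (¬_ ∘ T ∘ R) (insertions vA₁ (vB j ∷ u))
    bⱼ-first u = rejects-b-after-a₁ j u ∷ AllP.map⁺ (All.universal (rejects-b-first j) _)
    rest-rejected : All (¬_ ∘ T ∘ R) rest
    rest-rejected = AllP.++⁺ (AllP.map⁺ (AllP.map⁺ (All.universal (rejects-b-after-a₂ j) (insertions vA₁ (map vB σ′)))))
                             (AllP.concat⁺ (AllP.map⁺ (AllP.map⁺ (All.universal bⱼ-first (insertions vA₂ (map vB σ′))))))

  linExt-G2 : linExt (G2 n) ≡ concatMap frontPairs (perms (allFin n))
  linExt-G2 = begin
    filterᵇ R (perms (allFin (2 Nat.+ n)))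
      ≡⟨ cong (filterᵇ R ∘ perms ∘ (λ l → vA₁ ∷ vA₂ ∷ l)) (map-tabulate id vB) ⟨
    filterᵇ R (concatMap (insertions vA₁) (concatMap (insertions vA₂) (perms (map vB (allFin n)))))
      ≡⟨ cong (λ P → filterᵇ R (concatMap (insertions vA₁) (concatMap (insertions vA₂) P))) (perms-map vB (allFin n)) ⟩
    filterᵇ R (concatMap (insertions vA₁) (concatMap (insertions vA₂) (map (map vB) Σ)))
      ≡⟨ cong (filterᵇ R ∘ concatMap (insertions vA₁)) (concatMap-map (insertions vA₂) (map vB) Σ) ⟩
    filterᵇ R (concatMap (insertions vA₁) (concatMap (insertions vA₂ ∘ map vB) Σ))
      ≡⟨ cong (filterᵇ R) (concatMap-concatMap (insertions vA₁) (insertions vA₂ ∘ map vB) Σ) ⟩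
    filterᵇ R (concatMap candidates Σ)       ≡⟨ filter-concatMap respects? candidates Σ ⟩
    concatMap (filterᵇ R ∘ candidates) Σ     ≡⟨ concatMap-cong candidates-filter Σ ⟩
    concatMap frontPairs Σ                   ∎
    where
    R = respects (G2 n)
    Σ = perms (allFin n)

-- The right-hand side telescopes

allFin-suc : (m : ℕ) → allFin (Nat.suc m) ≡ zero ∷ map suc (allFin m)
allFin-suc m = cong (zero ∷_) (sym (map-tabulate id suc))

module RightHandSide (a₁ a₂ : ℚ) where

  diffProd : ℚ → {m : ℕ} → (Fin m → ℚ) → ℚ
  diffProd y {m} b = prodℚ (map (λ i → y - b i) (allFin m))

  diffProd-suc : (y : ℚ) {m : ℕ} (b : Fin (Nat.suc m) → ℚ) → diffProd y b ≡ (y - b zero) * diffProd y (b ∘ suc)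
  diffProd-suc y {m} b = begin
    prodℚ (map (λ i → y - b i) (allFin (Nat.suc m)))         ≡⟨ cong (prodℚ ∘ map (λ i → y - b i)) (allFin-suc m) ⟩
    (y - b zero) * prodℚ (map (λ i → y - b i) (map suc L)) ≡⟨ cong (λ l → (y - b zero) * prodℚ l) (map-∘ L) ⟨
    (y - b zero) * diffProd y (b ∘ suc)                    ∎
    where L = allFin m

  summand : {m : ℕ} → (Fin m → ℚ) → List (Fin m) → Fin m → ℚ
  summand b K i = prodℚ (map (λ j → a₁ - b j) (filterᵇ (λ j → toℕ j Nat.<ᵇ toℕ i) K))
                * prodℚ (map (λ k → a₂ - b k) (filterᵇ (λ k → toℕ i Nat.<ᵇ toℕ k) K))

  summand-zero : {m : ℕ} (b : Fin (Nat.suc m) → ℚ) → summand b (zero ∷ map suc (allFin m)) zero ≡ diffProd a₂ (b ∘ suc)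
  summand-zero {m} b = begin
    summand b (zero ∷ map suc L) zero
      ≡⟨ cong (λ X → prodℚ (map (λ j → a₁ - b j) X) * prodℚ (map (λ k → a₂ - b k) (filterᵇ (λ k → 0 Nat.<ᵇ toℕ k) (map suc L))))
           (filter-none (T? ∘ λ j → toℕ j Nat.<ᵇ 0) (All.universal (λ _ ()) (zero ∷ map suc L))) ⟩
    1ℚ * prodℚ (map (λ k → a₂ - b k) (filterᵇ (λ k → 0 Nat.<ᵇ toℕ k) (map suc L)))
      ≡⟨ ℚ.*-identityˡ _ ⟩
    prodℚ (map (λ k → a₂ - b k) (filterᵇ (λ k → 0 Nat.<ᵇ toℕ k) (map suc L)))
      ≡⟨ cong (prodℚ ∘ map (λ k → a₂ - b k)) (filterᵇ-map (λ k → 0 Nat.<ᵇ toℕ k) suc L) ⟩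
    prodℚ (map (λ k → a₂ - b k) (map suc (filterᵇ (λ _ → true) L)))
      ≡⟨ cong (prodℚ ∘ map (λ k → a₂ - b k) ∘ map suc) (filter-all (T? ∘ λ _ → true) (All.universal _ L)) ⟩
    prodℚ (map (λ k → a₂ - b k) (map suc L))
      ≡⟨ cong prodℚ (map-∘ L) ⟨
    diffProd a₂ (b ∘ suc) ∎
    where L = allFin m

  summand-suc : {m : ℕ} (b : Fin (Nat.suc m) → ℚ) (i : Fin m) →
    summand b (zero ∷ map suc (allFin m)) (suc i) ≡ (a₁ - b zero) * summand (b ∘ suc) (allFin m) i
  summand-suc {m} b i = begin
    ((a₁ - b zero) * prodℚ (map (λ j → a₁ - b j) (filterᵇ (λ j → toℕ j Nat.<ᵇ Nat.suc (toℕ i)) (map suc L))))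
      * prodℚ (map (λ k → a₂ - b k) (filterᵇ (λ k → Nat.suc (toℕ i) Nat.<ᵇ toℕ k) (map suc L)))
      ≡⟨ cong₂ (λ X Y → ((a₁ - b zero) * prodℚ (map (λ j → a₁ - b j) X)) * prodℚ (map (λ k → a₂ - b k) Y))
           (filterᵇ-map (λ j → toℕ j Nat.<ᵇ Nat.suc (toℕ i)) suc L) (filterᵇ-map (λ k → Nat.suc (toℕ i) Nat.<ᵇ toℕ k) suc L) ⟩
    ((a₁ - b zero) * prodℚ (map (λ j → a₁ - b j) (map suc F₁))) * prodℚ (map (λ k → a₂ - b k) (map suc F₂))
      ≡⟨ cong₂ (λ X Y → ((a₁ - b zero) * prodℚ X) * prodℚ Y) (map-∘ F₁) (map-∘ F₂) ⟨
    ((a₁ - b zero) * prodℚ (map (λ j → a₁ - b (suc j)) F₁)) * prodℚ (map (λ k → a₂ - b (suc k)) F₂)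
      ≡⟨ ℚ.*-assoc (a₁ - b zero) _ _ ⟩
    (a₁ - b zero) * summand (b ∘ suc) L i ∎
    where
    L = allFin m
    F₁ = filterᵇ (λ j → toℕ j Nat.<ᵇ toℕ i) L
    F₂ = filterᵇ (λ k → toℕ i Nat.<ᵇ toℕ k) L

  rhs-suc : {m : ℕ} (b : Fin (Nat.suc m) → ℚ) →
    rhsG2 a₁ a₂ b ≡ diffProd a₂ (b ∘ suc) + (a₁ - b zero) * rhsG2 a₁ a₂ (b ∘ suc)
  rhs-suc {m} b = begin
    rhsG2 a₁ a₂ b                                             ≡⟨ cong (λ K → sumℚ (map (summand b K) K)) (allFin-suc m) ⟩
    summand b K zero + sumℚ (map (summand b K) (map suc L))   ≡⟨ cong (summand b K zero +_) (cong sumℚ (map-∘ L)) ⟨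
    summand b K zero + sumℚ (map (summand b K ∘ suc) L)       ≡⟨ cong₂ _+_ (summand-zero b) (cong sumℚ (map-cong (summand-suc b) L)) ⟩
    diffProd a₂ (b ∘ suc) + sumℚ (map (λ i → (a₁ - b zero) * summand (b ∘ suc) L i) L)
      ≡⟨ cong (diffProd a₂ (b ∘ suc) +_) (sumℚ-*ˡ (a₁ - b zero) (summand (b ∘ suc) L) L) ⟩
    diffProd a₂ (b ∘ suc) + (a₁ - b zero) * rhsG2 a₁ a₂ (b ∘ suc) ∎
    where
    L = allFin m
    K = zero ∷ map suc L

  rhs-telescope : {m : ℕ} (b : Fin m → ℚ) → rhsG2 a₁ a₂ b * (a₁ - a₂) ≡ diffProd a₁ b - diffProd a₂ b
  rhs-telescope {Nat.zero} b = trans (ℚ.*-zeroˡ (a₁ - a₂)) (sym (ℚ.+-inverseʳ 1ℚ))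
  rhs-telescope {Nat.suc m} b = begin
    rhsG2 a₁ a₂ b * (a₁ - a₂)                         ≡⟨ cong (_* (a₁ - a₂)) (rhs-suc b) ⟩
    (B + (a₁ - b zero) * R) * (a₁ - a₂)
      ≡⟨ solve 5 (λ B c R a d → (B :+ c :* R) :* d := B :* d :+ c :* (R :* d)) refl B (a₁ - b zero) R a₁ (a₁ - a₂) ⟩
    B * (a₁ - a₂) + (a₁ - b zero) * (R * (a₁ - a₂))   ≡⟨ cong (λ z → B * (a₁ - a₂) + (a₁ - b zero) * z) (rhs-telescope (b ∘ suc)) ⟩
    B * (a₁ - a₂) + (a₁ - b zero) * (A - B)
      ≡⟨ solve 5 (λ a₁ a₂ b₀ A B → B :* (a₁ :- a₂) :+ (a₁ :- b₀) :* (A :- B) := (a₁ :- b₀) :* A :- (a₂ :- b₀) :* B) refl a₁ a₂ (b zero) A B ⟩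
    (a₁ - b zero) * A - (a₂ - b zero) * B             ≡⟨ cong₂ _-_ (diffProd-suc a₁ b) (diffProd-suc a₂ b) ⟨
    diffProd a₁ b - diffProd a₂ b ∎
    where
    A = diffProd a₁ (b ∘ suc)
    B = diffProd a₂ (b ∘ suc)
    R = rhsG2 a₁ a₂ (b ∘ suc)

-- The closing field computation: with i = 1/(a₁ - a₂), Pₕ = 1/Dₕ and
-- R·(a₁ - a₂) = D₁ - D₂, one has (i·P₂ - i·P₁)·D₁·D₂ = R.
combine : (i d P₁ P₂ D₁ D₂ R : ℚ) → i * d ≡ 1ℚ → P₁ * D₁ ≡ 1ℚ → P₂ * D₂ ≡ 1ℚ → R * d ≡ D₁ - D₂ →
  (i * P₂ + (- i) * P₁) * (D₁ * D₂) ≡ R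
combine i d P₁ P₂ D₁ D₂ R id≡1 P₁D₁≡1 P₂D₂≡1 Rd≡D₁-D₂ = begin
  (i * P₂ + (- i) * P₁) * (D₁ * D₂)
    ≡⟨ solve 5 (λ i P₂ P₁ D₁ D₂ → (i :* P₂ :+ (:- i) :* P₁) :* (D₁ :* D₂) := (i :* D₁) :* (P₂ :* D₂) :- (i :* D₂) :* (P₁ :* D₁)) refl i P₂ P₁ D₁ D₂ ⟩
  (i * D₁) * (P₂ * D₂) - (i * D₂) * (P₁ * D₁)   ≡⟨ cong₂ (λ X Y → (i * D₁) * X - (i * D₂) * Y) P₂D₂≡1 P₁D₁≡1 ⟩
  (i * D₁) * 1ℚ - (i * D₂) * 1ℚ                 ≡⟨ solve 3 (λ i A B → (i :* A) :* con 1ℚ :- (i :* B) :* con 1ℚ := (A :- B) :* i) refl i D₁ D₂ ⟩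
  (D₁ - D₂) * i                                 ≡⟨ cong (_* i) Rd≡D₁-D₂ ⟨
  (R * d) * i                                   ≡⟨ solve 3 (λ R d i → (R :* d) :* i := R :* (i :* d)) refl R d i ⟩
  R * (i * d)                                   ≡⟨ cong (R *_) id≡1 ⟩
  R * 1ℚ                                        ≡⟨ ℚ.*-identityʳ R ⟩
  R                                             ∎

module G2-identity (n : ℕ) (a₁ a₂ : ℚ) (b : Fin n → ℚ) where

  open RightHandSide a₁ a₂

  x : Fin (2 Nat.+ n) → ℚ
  x = xG2 a₁ a₂ b

  bs : List ℚ
  bs = map b (allFin n)

  invProd : ℚ → ℚ
  invProd y = prodℚ (map (λ i → inv (y - b i)) (allFin n))

  values-distinct : ((u v : Fin (2 Nat.+ n)) → u ≢ v → x u ≢ x v) → Unique (a₁ ∷ a₂ ∷ bs)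
  values-distinct distinct = subst Unique values (Unique.map⁺ x-injective (Unique.allFin⁺ (2 Nat.+ n)))
    where
    x-injective : {u v : Fin (2 Nat.+ n)} → x u ≡ x v → u ≡ v
    x-injective {u} {v} xu≡xv = decidable-stable (u ≟ᶠ v) (λ u≢v → distinct u v u≢v xu≡xv)
    values : map x (allFin (2 Nat.+ n)) ≡ a₁ ∷ a₂ ∷ bs
    values = cong (λ l → a₁ ∷ a₂ ∷ l) (trans (map-tabulate vB x) (sym (map-tabulate id b)))

  sources-sum : (y : ℚ) → Unique (y ∷ bs) → sumℚ (map (λ σ → chainInv (y ∷ map b σ)) (perms (allFin n))) ≡ invProd y
  sources-sum y distinct = begin
    sumℚ (map (λ σ → chainInv (y ∷ map b σ)) (perms (allFin n)))      ≡⟨ cong sumℚ (map-∘ (perms (allFin n))) ⟩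
    sumℚ (map (λ τ → chainInv (y ∷ τ)) (map (map b) (perms (allFin n)))) ≡⟨ cong (sumℚ ∘ map (λ τ → chainInv (y ∷ τ))) (perms-map b (allFin n)) ⟨
    sumℚ (map (λ τ → chainInv (y ∷ τ)) (perms bs))                    ≡⟨ permutation-sum y bs distinct ⟩
    prodℚ (map (λ v → inv (y - v)) bs)                                 ≡⟨ cong prodℚ (map-∘ (allFin n)) ⟨
    invProd y                                                          ∎

  frontPairs-value : (σ : List (Fin n)) →
    sumℚ (map (consecInvProd x) (frontPairs σ)) ≡ inv (a₁ - a₂) * chainInv (a₂ ∷ map b σ) + inv (a₂ - a₁) * chainInv (a₁ ∷ map b σ)
  frontPairs-value σ = cong₂ _+_
    (trans (consecInvProd-chainInv x (vA₁ ∷ vA₂ ∷ map vB σ)) (cong (λ l → inv (a₁ - a₂) * chainInv (a₂ ∷ l)) sinks))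
    (trans (ℚ.+-identityʳ _)
      (trans (consecInvProd-chainInv x (vA₂ ∷ vA₁ ∷ map vB σ)) (cong (λ l → inv (a₂ - a₁) * chainInv (a₁ ∷ l)) sinks)))
    where
    sinks : map x (map vB σ) ≡ map b σ
    sinks = sym (map-∘ σ)

  Ψ-G2 : Unique (a₁ ∷ bs) → Unique (a₂ ∷ bs) → Ψ (G2 n) x ≡ inv (a₁ - a₂) * invProd a₂ + inv (a₂ - a₁) * invProd a₁
  Ψ-G2 distinct₁ distinct₂ = begin
    sumℚ (map c (linExt (G2 n)))                                    ≡⟨ cong (sumℚ ∘ map c) linExt-G2 ⟩
    sumℚ (map c (concatMap frontPairs Σ))                           ≡⟨ sumℚ-concatMap c frontPairs Σ ⟩
    sumℚ (map (λ σ → sumℚ (map c (frontPairs σ))) Σ)                ≡⟨ cong sumℚ (map-cong frontPairs-value Σ) ⟩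
    sumℚ (map (λ σ → i₁₂ * g a₂ σ + i₂₁ * g a₁ σ) Σ)                ≡⟨ sumℚ-+ (λ σ → i₁₂ * g a₂ σ) (λ σ → i₂₁ * g a₁ σ) Σ ⟩
    sumℚ (map (λ σ → i₁₂ * g a₂ σ) Σ) + sumℚ (map (λ σ → i₂₁ * g a₁ σ) Σ)
      ≡⟨ cong₂ _+_ (sumℚ-*ˡ i₁₂ (g a₂) Σ) (sumℚ-*ˡ i₂₁ (g a₁) Σ) ⟩
    i₁₂ * sumℚ (map (g a₂) Σ) + i₂₁ * sumℚ (map (g a₁) Σ)           ≡⟨ cong₂ (λ X Y → i₁₂ * X + i₂₁ * Y) (sources-sum a₂ distinct₂) (sources-sum a₁ distinct₁) ⟩
    i₁₂ * invProd a₂ + i₂₁ * invProd a₁                              ∎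
    where
    c = consecInvProd x
    Σ = perms (allFin n)
    i₁₂ = inv (a₁ - a₂)
    i₂₁ = inv (a₂ - a₁)
    g : ℚ → List (Fin n) → ℚ
    g y σ = chainInv (y ∷ map b σ)

  edgeProd-G2 : prodℚ (map (λ { (u , v) → x u - x v }) (edges (G2 n))) ≡ diffProd a₁ b * diffProd a₂ b
  edgeProd-G2 = begin
    prodℚ (map f (E₁ ++ E₂))                 ≡⟨ cong prodℚ (map-++ f E₁ E₂) ⟩
    prodℚ (map f E₁ ++ map f E₂)             ≡⟨ prodℚ-++ (map f E₁) (map f E₂) ⟩
    prodℚ (map f E₁) * prodℚ (map f E₂)      ≡⟨ cong₂ (λ X Y → prodℚ X * prodℚ Y) (map-∘ (allFin n)) (map-∘ (allFin n)) ⟨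
    diffProd a₁ b * diffProd a₂ b            ∎
    where
    f : Fin (2 Nat.+ n) × Fin (2 Nat.+ n) → ℚ
    f = λ { (u , v) → x u - x v }
    E₁ = map (λ i → (vA₁ , vB i)) (allFin n)
    E₂ = map (λ i → (vA₂ , vB i)) (allFin n)

  invProd-diffProd : (y : ℚ) → Unique (y ∷ bs) → invProd y * diffProd y b ≡ 1ℚ
  invProd-diffProd y (y≢bs ∷ _) = prodℚ-inv (λ i → y - b i) (allFin n) (All.map diff≢0 (AllP.map⁻ y≢bs))

mainTheorem6 : (n : ℕ) → 1 ≤ n → (a₁ a₂ : ℚ) → (b : Fin n → ℚ)
    → ((u v : Fin (2 Data.Nat.+ n)) → u ≢ v → xG2 a₁ a₂ b u ≢ xG2 a₁ a₂ b v)
    → N (G2 n) (xG2 a₁ a₂ b) ≡ rhsG2 a₁ a₂ b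
mainTheorem6 n _ a₁ a₂ b distinct
  with (a₁≢a₂ ∷ a₁≢bs) ∷ a₂≢bs ∷ bs-distinct ← G2-identity.values-distinct n a₁ a₂ b distinct = begin
  Ψ (G2 n) x * prodℚ (map (λ { (u , v) → x u - x v }) (edges (G2 n)))
    ≡⟨ cong₂ _*_ (Ψ-G2 (a₁≢bs ∷ bs-distinct) (a₂≢bs ∷ bs-distinct)) edgeProd-G2 ⟩
  (inv (a₁ - a₂) * invProd a₂ + inv (a₂ - a₁) * invProd a₁) * (diffProd a₁ b * diffProd a₂ b)
    ≡⟨ cong (λ z → (inv (a₁ - a₂) * invProd a₂ + z * invProd a₁) * (diffProd a₁ b * diffProd a₂ b)) (inv-antisym a₁≢a₂) ⟩
  (inv (a₁ - a₂) * invProd a₂ + (- inv (a₁ - a₂)) * invProd a₁) * (diffProd a₁ b * diffProd a₂ b)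
    ≡⟨ combine (inv (a₁ - a₂)) (a₁ - a₂) (invProd a₁) (invProd a₂) (diffProd a₁ b) (diffProd a₂ b) (rhsG2 a₁ a₂ b)
         (inv-inverseˡ (a₁ - a₂) (diff≢0 a₁≢a₂))
         (invProd-diffProd a₁ (a₁≢bs ∷ bs-distinct)) (invProd-diffProd a₂ (a₂≢bs ∷ bs-distinct)) (rhs-telescope b) ⟩
  rhsG2 a₁ a₂ b ∎
  where
  open G2-identity n a₁ a₂ b
  open RightHandSide a₁ a₂
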